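{- ($\mathsf{SIE}_1$) If $\alpha$ is an ordinal and $A$ is an inhabited subset of $\alpha$, then $A$ has an $\in$-minimal element, i.e. there is $a\in A$ such that no $b\in A$ satisfies $b\in a$.
   Context: An ordinal is a transitive set all of whose elements are transitive. $\mathsf{SIE}_1$ is the intuitionistic set theory with axioms Extensionality, Pairing, Union, Binary Intersection, $V=\mathrm{Fin}$ (every set is in bijection with a von Neumann natural number), and Set Induction $\forall x[\forall y\in x\phi(y)\to\phi(x)]\to\forall x\phi(x)$ restricted to $\mathcal E_1$-formulas $\phi$, where $\mathcal E_1$ is the closure of the bounded ($\Delta_0$) formulas under $\land,\lor$, bounded quantifiers and $\exists$ (up to provable equivalence). -}

module Defs where

-- Deep embedding of intuitionistic first-order logic over the language {∈, =}
-- (variables as de Bruijn indices), together with the theory SIE₁.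

open import Data.Nat using (ℕ; zero; suc)
open import Data.Fin using (Fin; zero; suc)
open import Data.List using (List; []; _∷_; map)
open import Data.List.Membership.Propositional using (_∈_)

infix  7 _∈̇_ _≐_
infixr 6 _∧̇_
infixr 5 _∨̇_
infixr 4 _⇒̇_ _⇔̇_

data Formula (n : ℕ) : Set where
  _∈̇_ _≐_      : Fin n → Fin n → Formula n
  ⊥̇            : Formula n
  _∧̇_ _∨̇_ _⇒̇_ : Formula n → Formula n → Formula n
  ∀̇ ∃̇          : Formula (suc n) → Formula n

¬̇_ : ∀ {n} → Formula n → Formula n
¬̇ φ = φ ⇒̇ ⊥̇

_⇔̇_ : ∀ {n} → Formula n → Formula n → Formula n
φ ⇔̇ ψ = (φ ⇒̇ ψ) ∧̇ (ψ ⇒̇ φ)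

lift : ∀ {n m} → (Fin n → Fin m) → Fin (suc n) → Fin (suc m)
lift ρ zero    = zero
lift ρ (suc i) = suc (ρ i)

rename : ∀ {n m} → (Fin n → Fin m) → Formula n → Formula m
rename ρ (x ∈̇ y) = ρ x ∈̇ ρ y
rename ρ (x ≐ y) = ρ x ≐ ρ y
rename ρ ⊥̇       = ⊥̇
rename ρ (φ ∧̇ ψ) = rename ρ φ ∧̇ rename ρ ψ
rename ρ (φ ∨̇ ψ) = rename ρ φ ∨̇ rename ρ ψ
rename ρ (φ ⇒̇ ψ) = rename ρ φ ⇒̇ rename ρ ψ
rename ρ (∀̇ φ)   = ∀̇ (rename (lift ρ) φ)
rename ρ (∃̇ φ)   = ∃̇ (rename (lift ρ) φ)

wk : ∀ {n} → Formula n → Formula (suc n)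
wk = rename suc

-- substitution of the variable x for variable 0 (terms are variables only)
sub0 : ∀ {n} → Fin n → Fin (suc n) → Fin n
sub0 x zero    = x
sub0 x (suc i) = i

_[_] : ∀ {n} → Formula (suc n) → Fin n → Formula n
φ [ x ] = rename (sub0 x) φ

close : ∀ {n} → Formula 0 → Formula n
close = rename (λ ())

-- bounded quantifiers:  ∀y∈x φ(y)  and  ∃y∈x φ(y)   (y is variable 0 of φ)
∀∈ : ∀ {n} → Fin n → Formula (suc n) → Formula n
∀∈ x φ = ∀̇ (zero ∈̇ suc x ⇒̇ φ)

∃∈ : ∀ {n} → Fin n → Formula (suc n) → Formula n
∃∈ x φ = ∃̇ (zero ∈̇ suc x ∧̇ φ)

data Δ₀ {n : ℕ} : Formula n → Set where
  mem  : ∀ x y → Δ₀ (x ∈̇ y)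
  eq   : ∀ x y → Δ₀ (x ≐ y)
  bot  : Δ₀ ⊥̇
  and  : ∀ {φ ψ} → Δ₀ φ → Δ₀ ψ → Δ₀ (φ ∧̇ ψ)
  or   : ∀ {φ ψ} → Δ₀ φ → Δ₀ ψ → Δ₀ (φ ∨̇ ψ)
  imp  : ∀ {φ ψ} → Δ₀ φ → Δ₀ ψ → Δ₀ (φ ⇒̇ ψ)
  ball : ∀ {φ} (x : Fin n) → Δ₀ φ → Δ₀ (∀∈ x φ)
  bex  : ∀ {φ} (x : Fin n) → Δ₀ φ → Δ₀ (∃∈ x φ)

data E₁ {n : ℕ} : Formula n → Set where
  δ    : ∀ {φ} → Δ₀ φ → E₁ φ
  and  : ∀ {φ ψ} → E₁ φ → E₁ ψ → E₁ (φ ∧̇ ψ)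
  or   : ∀ {φ ψ} → E₁ φ → E₁ ψ → E₁ (φ ∨̇ ψ)
  ball : ∀ {φ} (x : Fin n) → E₁ φ → E₁ (∀∈ x φ)
  bex  : ∀ {φ} (x : Fin n) → E₁ φ → E₁ (∃∈ x φ)
  ex   : ∀ {φ} → E₁ φ → E₁ (∃̇ φ)

_⊆̇_ : ∀ {n} → Fin n → Fin n → Formula n
x ⊆̇ y = ∀∈ x (zero ∈̇ suc y)

Trans : ∀ {n} → Fin n → Formula n
Trans x = ∀∈ x (∀∈ zero (zero ∈̇ suc (suc x)))

Ord : ∀ {n} → Fin n → Formula n
Ord x = Trans x ∧̇ ∀∈ x (Trans zero)

IsEmpty : ∀ {n} → Fin n → Formula n
IsEmpty x = ∀̇ (¬̇ (zero ∈̇ suc x))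

IsSucc : ∀ {n} → Fin n → Fin n → Formula n
IsSucc y z = ∀̇ (zero ∈̇ suc y ⇔̇ (zero ∈̇ suc z ∨̇ zero ≐ suc z))

ZeroOrSucc : ∀ {n} → Fin n → Formula n
ZeroOrSucc y = IsEmpty y ∨̇ ∃∈ y (IsSucc (suc y) zero)

Nat : ∀ {n} → Fin n → Formula n
Nat x = Ord x ∧̇ ZeroOrSucc x ∧̇ ∀∈ x (ZeroOrSucc zero)

IsSing : ∀ {n} → Fin n → Fin n → Formula n
IsSing w u = ∀̇ (zero ∈̇ suc w ⇔̇ zero ≐ suc u)

IsUPair : ∀ {n} → Fin n → Fin n → Fin n → Formula n
IsUPair w u v = ∀̇ (zero ∈̇ suc w ⇔̇ (zero ≐ suc u ∨̇ zero ≐ suc v))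

-- p = ⟨u, v⟩ = {{u}, {u, v}}  (Kuratowski pair)
IsOPair : ∀ {n} → Fin n → Fin n → Fin n → Formula n
IsOPair p u v =
  ∀̇ (zero ∈̇ suc p ⇔̇ (IsSing zero (suc u) ∨̇ IsUPair zero (suc u) (suc v)))

-- f is a bijection from x onto m (f a set of Kuratowski pairs)
Bij : ∀ {n} → Fin n → Fin n → Fin n → Formula n
Bij f x m =
  -- every element of f is a pair ⟨u,v⟩ with u ∈ x, v ∈ m
  ∀∈ f (∃∈ (suc x) (∃∈ (suc (suc m))
        (IsOPair (suc (suc zero)) (suc zero) zero)))
  -- total: every u ∈ x has some ⟨u,v⟩ ∈ f with v ∈ m
  ∧̇ ∀∈ x (∃∈ (suc m) (∃∈ (suc (suc f))
        (IsOPair zero (suc (suc zero)) (suc zero))))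
  -- functional
  ∧̇ ∀∈ f (∀∈ (suc f) (∀̇ (∀̇ (∀̇
        (IsOPair (suc (suc (suc (suc zero)))) (suc (suc zero)) (suc zero)
         ∧̇ IsOPair (suc (suc (suc zero))) (suc (suc zero)) zero
         ⇒̇ suc zero ≐ zero)))))
  -- injective
  ∧̇ ∀∈ f (∀∈ (suc f) (∀̇ (∀̇ (∀̇
        (IsOPair (suc (suc (suc (suc zero)))) (suc (suc zero)) zero
         ∧̇ IsOPair (suc (suc (suc zero))) (suc zero) zero
         ⇒̇ suc (suc zero) ≐ suc zero)))))
  -- surjective onto m
  ∧̇ ∀∈ m (∃∈ (suc x) (∃∈ (suc (suc f))
        (IsOPair zero (suc zero) (suc (suc zero)))))

data Axiom : Formula 0 → Set where
  extensionality : Axiom (∀̇ (∀̇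
    (∀̇ (zero ∈̇ suc (suc zero) ⇔̇ zero ∈̇ suc zero) ⇒̇ suc zero ≐ zero)))
  pairing : Axiom (∀̇ (∀̇ (∃̇ (∀̇
    (zero ∈̇ suc zero ⇔̇ (zero ≐ suc (suc (suc zero)) ∨̇ zero ≐ suc (suc zero)))))))
  union : Axiom (∀̇ (∃̇ (∀̇
    (zero ∈̇ suc zero ⇔̇ ∃∈ (suc (suc zero)) (suc zero ∈̇ zero)))))
  intersection : Axiom (∀̇ (∀̇ (∃̇ (∀̇
    (zero ∈̇ suc zero ⇔̇ (zero ∈̇ suc (suc (suc zero)) ∧̇ zero ∈̇ suc (suc zero)))))))
  -- V = Fin: ∀x∃n(n is a natural number ∧ ∃f (f is a bijection x → n))
  vfin : Axiom (∀̇ (∃̇ (Nat zero ∧̇ ∃̇ (Bij zero (suc (suc zero)) (suc zero)))))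

Ind : ∀ {n} → Formula (suc n) → Formula n
Ind φ = ∀̇ (∀∈ zero (rename (lift suc) φ) ⇒̇ φ) ⇒̇ ∀̇ φ

infix 2 _⊢_

data _⊢_ : {n : ℕ} → List (Formula n) → Formula n → Set where
  hyp    : ∀ {n} {Γ : List (Formula n)} {φ} → φ ∈ Γ → Γ ⊢ φ
  axm    : ∀ {n} {Γ : List (Formula n)} {σ} → Axiom σ → Γ ⊢ close σ
  ind    : ∀ {n} {Γ : List (Formula n)} {φ} → E₁ φ → Γ ⊢ Ind φ
  ⊥E     : ∀ {n} {Γ : List (Formula n)} {φ} → Γ ⊢ ⊥̇ → Γ ⊢ φ
  ∧I     : ∀ {n} {Γ : List (Formula n)} {φ ψ} → Γ ⊢ φ → Γ ⊢ ψ → Γ ⊢ φ ∧̇ ψ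
  ∧E₁    : ∀ {n} {Γ : List (Formula n)} {φ ψ} → Γ ⊢ φ ∧̇ ψ → Γ ⊢ φ
  ∧E₂    : ∀ {n} {Γ : List (Formula n)} {φ ψ} → Γ ⊢ φ ∧̇ ψ → Γ ⊢ ψ
  ∨I₁    : ∀ {n} {Γ : List (Formula n)} {φ ψ} → Γ ⊢ φ → Γ ⊢ φ ∨̇ ψ
  ∨I₂    : ∀ {n} {Γ : List (Formula n)} {φ ψ} → Γ ⊢ ψ → Γ ⊢ φ ∨̇ ψ
  ∨E     : ∀ {n} {Γ : List (Formula n)} {φ ψ χ} →
           Γ ⊢ φ ∨̇ ψ → (φ ∷ Γ) ⊢ χ → (ψ ∷ Γ) ⊢ χ → Γ ⊢ χ
  ⇒I     : ∀ {n} {Γ : List (Formula n)} {φ ψ} → (φ ∷ Γ) ⊢ ψ → Γ ⊢ φ ⇒̇ ψ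
  ⇒E     : ∀ {n} {Γ : List (Formula n)} {φ ψ} → Γ ⊢ φ ⇒̇ ψ → Γ ⊢ φ → Γ ⊢ ψ
  ∀I     : ∀ {n} {Γ : List (Formula n)} {φ} → map wk Γ ⊢ φ → Γ ⊢ ∀̇ φ
  ∀E     : ∀ {n} {Γ : List (Formula n)} {φ} → Γ ⊢ ∀̇ φ → (x : Fin n) → Γ ⊢ φ [ x ]
  ∃I     : ∀ {n} {Γ : List (Formula n)} {φ} (x : Fin n) → Γ ⊢ φ [ x ] → Γ ⊢ ∃̇ φ
  ∃E     : ∀ {n} {Γ : List (Formula n)} {φ ψ} →
           Γ ⊢ ∃̇ φ → (φ ∷ map wk Γ) ⊢ wk ψ → Γ ⊢ ψ
  ≐refl  : ∀ {n} {Γ : List (Formula n)} (x : Fin n) → Γ ⊢ x ≐ x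
  ≐subst : ∀ {n} {Γ : List (Formula n)} {x y} (φ : Formula (suc n)) →
           Γ ⊢ x ≐ y → Γ ⊢ φ [ x ] → Γ ⊢ φ [ y ]

SIE₁⊢ : Formula 0 → Set
SIE₁⊢ σ = [] ⊢ σ

MinimalElementSentence : Formula 0
MinimalElementSentence =
  ∀̇ (Ord zero ⇒̇                                   -- α = 0
    ∀̇ (zero ⊆̇ suc zero ⇒̇                          -- A = 0, α = 1
       ∃̇ (zero ∈̇ suc zero) ⇒̇
       ∃∈ zero (¬̇ ∃∈ (suc zero) (zero ∈̇ suc zero))))  -- a = 0, A = 1; b = 0, a = 1

module Submission where

-- SIE₁ has no separation, so a minimal element has to be found by search. Every set is
-- finite (V = Fin): if f is a bijection from x onto a natural number N and the Δ₀ property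
-- φ is decidable on x, then ∃y∈x φ(y) is decidable, by ∈-induction on m ≤ N for the Δ₀
-- statement "it is decidable whether some y ∈ x with φ(y) has f(y) ∈ m". For a transitive
-- set α this makes equality and membership between elements of α decidable, again by
-- ∈-induction (b = y is decided through the bounded inclusions b ⊆ y and y ⊆ b). Finally,
-- if membership is decidable on A and x ∈ A, ∈-induction on x gives an ∈-minimal element:
-- either some b ∈ A lies in x, and we pass to b, or x itself is minimal.

open import Defs
open import Agda.Builtin.FromNat using (Number; fromNat)
open import Data.Nat using (ℕ; suc)
open import Data.Fin using (Fin; zero; suc)
import Data.Fin.Literals as Fin
open import Data.List using (List; []; _∷_; _++_; map; length; lookup)
open import Data.List.Membership.Propositional.Properties using (∈-lookup)
open import Data.List.Relation.Binary.Subset.Propositional using (_⊆_)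
open import Data.List.Relation.Binary.Subset.Propositional.Properties using (map⁺; ∷⁺ʳ)
open import Data.List.Relation.Unary.All using (All; []; _∷_)
open import Data.List.Relation.Unary.Any using (here; there)
open import Data.Unit using (tt)
open import Relation.Binary.PropositionalEquality using (_≡_; refl; sym; trans; cong; cong₂)

-- Numeric literals are de Bruijn indices: of variables in formulas and, via #, of
-- hypotheses in a context, 0 being the most recent one (fromNat and tt are what make
-- these literals elaborate).
instance
  finLiterals : ∀ {n} → Number (Fin n)
  finLiterals = Fin.number _

private variable
  n : ℕ
  Γ Δ : List (Formula n)
  φ ψ : Formula n
  x y z : Fin n

weaken : Γ ⊆ Δ → Γ ⊢ φ → Δ ⊢ φ
weaken s (hyp p)        = hyp (s p)
weaken s (axm a)        = axm a
weaken s (ind e)        = ind e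
weaken s (⊥E d)         = ⊥E (weaken s d)
weaken s (∧I d e)       = ∧I (weaken s d) (weaken s e)
weaken s (∧E₁ d)        = ∧E₁ (weaken s d)
weaken s (∧E₂ d)        = ∧E₂ (weaken s d)
weaken s (∨I₁ d)        = ∨I₁ (weaken s d)
weaken s (∨I₂ d)        = ∨I₂ (weaken s d)
weaken s (∨E d e f)     = ∨E (weaken s d) (weaken (∷⁺ʳ _ s) e) (weaken (∷⁺ʳ _ s) f)
weaken s (⇒I d)         = ⇒I (weaken (∷⁺ʳ _ s) d)
weaken s (⇒E d e)       = ⇒E (weaken s d) (weaken s e)
weaken s (∀I d)         = ∀I (weaken (map⁺ wk s) d)
weaken s (∀E d x)       = ∀E (weaken s d) x
weaken s (∃I x d)       = ∃I x (weaken s d)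
weaken s (∃E d e)       = ∃E (weaken s d) (weaken (∷⁺ʳ _ (map⁺ wk s)) e)
weaken s (≐refl x)      = ≐refl x
weaken s (≐subst φ d e) = ≐subst φ (weaken s d) (weaken s e)

#_ : (i : Fin (length Γ)) → Γ ⊢ lookup Γ i
# i = hyp (∈-lookup i)

cut : Γ ⊢ φ → (φ ∷ Γ) ⊢ ψ → Γ ⊢ ψ
cut d e = ⇒E (⇒I e) d

assume : All (Γ ⊢_) Δ → (Δ ++ Γ) ⊢ φ → Γ ⊢ φ
assume []       e = e
assume (d ∷ ds) e = ⇒E (assume ds (⇒I e)) d

cast : φ ≡ ψ → Γ ⊢ φ → Γ ⊢ ψ
cast refl d = d

lift-cong : ∀ {m} {ρ σ : Fin n → Fin m} → (∀ i → ρ i ≡ σ i) → ∀ i → lift ρ i ≡ lift σ i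
lift-cong e zero    = refl
lift-cong e (suc i) = cong suc (e i)

rename-cong : ∀ {m} {ρ σ : Fin n → Fin m} → (∀ i → ρ i ≡ σ i) → ∀ φ → rename ρ φ ≡ rename σ φ
rename-cong e (x ∈̇ y) = cong₂ _∈̇_ (e x) (e y)
rename-cong e (x ≐ y) = cong₂ _≐_ (e x) (e y)
rename-cong e ⊥̇       = refl
rename-cong e (φ ∧̇ ψ) = cong₂ _∧̇_ (rename-cong e φ) (rename-cong e ψ)
rename-cong e (φ ∨̇ ψ) = cong₂ _∨̇_ (rename-cong e φ) (rename-cong e ψ)
rename-cong e (φ ⇒̇ ψ) = cong₂ _⇒̇_ (rename-cong e φ) (rename-cong e ψ)
rename-cong e (∀̇ φ)   = cong ∀̇ (rename-cong (lift-cong e) φ)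
rename-cong e (∃̇ φ)   = cong ∃̇ (rename-cong (lift-cong e) φ)

lift-∘ : ∀ {m k} (ρ : Fin m → Fin k) (σ : Fin n → Fin m) →
         ∀ i → lift ρ (lift σ i) ≡ lift (λ j → ρ (σ j)) i
lift-∘ ρ σ zero    = refl
lift-∘ ρ σ (suc i) = refl

rename-∘ : ∀ {m k} (ρ : Fin m → Fin k) (σ : Fin n → Fin m) φ →
           rename ρ (rename σ φ) ≡ rename (λ i → ρ (σ i)) φ
rename-∘ ρ σ (x ∈̇ y) = refl
rename-∘ ρ σ (x ≐ y) = refl
rename-∘ ρ σ ⊥̇       = refl
rename-∘ ρ σ (φ ∧̇ ψ) = cong₂ _∧̇_ (rename-∘ ρ σ φ) (rename-∘ ρ σ ψ)
rename-∘ ρ σ (φ ∨̇ ψ) = cong₂ _∨̇_ (rename-∘ ρ σ φ) (rename-∘ ρ σ ψ)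
rename-∘ ρ σ (φ ⇒̇ ψ) = cong₂ _⇒̇_ (rename-∘ ρ σ φ) (rename-∘ ρ σ ψ)
rename-∘ ρ σ (∀̇ φ)   = cong ∀̇ (trans (rename-∘ (lift ρ) (lift σ) φ) (rename-cong (lift-∘ ρ σ) φ))
rename-∘ ρ σ (∃̇ φ)   = cong ∃̇ (trans (rename-∘ (lift ρ) (lift σ) φ) (rename-cong (lift-∘ ρ σ) φ))

lift-id : {ρ : Fin n → Fin n} → (∀ i → ρ i ≡ i) → ∀ i → lift ρ i ≡ i
lift-id e zero    = refl
lift-id e (suc i) = cong suc (e i)

rename-id : {ρ : Fin n → Fin n} → (∀ i → ρ i ≡ i) → ∀ φ → rename ρ φ ≡ φ
rename-id e (x ∈̇ y) = cong₂ _∈̇_ (e x) (e y)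
rename-id e (x ≐ y) = cong₂ _≐_ (e x) (e y)
rename-id e ⊥̇       = refl
rename-id e (φ ∧̇ ψ) = cong₂ _∧̇_ (rename-id e φ) (rename-id e ψ)
rename-id e (φ ∨̇ ψ) = cong₂ _∨̇_ (rename-id e φ) (rename-id e ψ)
rename-id e (φ ⇒̇ ψ) = cong₂ _⇒̇_ (rename-id e φ) (rename-id e ψ)
rename-id e (∀̇ φ)   = cong ∀̇ (rename-id (lift-id e) φ)
rename-id e (∃̇ φ)   = cong ∃̇ (rename-id (lift-id e) φ)

Δ₀-rename : ∀ {m} (ρ : Fin n → Fin m) → Δ₀ φ → Δ₀ (rename ρ φ)
Δ₀-rename ρ (mem x y)  = mem (ρ x) (ρ y)
Δ₀-rename ρ (eq x y)   = eq (ρ x) (ρ y)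
Δ₀-rename ρ bot        = bot
Δ₀-rename ρ (and d e)  = and (Δ₀-rename ρ d) (Δ₀-rename ρ e)
Δ₀-rename ρ (or d e)   = or (Δ₀-rename ρ d) (Δ₀-rename ρ e)
Δ₀-rename ρ (imp d e)  = imp (Δ₀-rename ρ d) (Δ₀-rename ρ e)
Δ₀-rename ρ (ball x d) = ball (ρ x) (Δ₀-rename (lift ρ) d)
Δ₀-rename ρ (bex x d)  = bex (ρ x) (Δ₀-rename (lift ρ) d)

lift-suc-[zero] : (φ : Formula (suc n)) → rename (lift suc) φ [ zero ] ≡ φ
lift-suc-[zero] φ =
  trans (rename-∘ (sub0 zero) (lift suc) φ) (rename-id (λ { zero → refl ; (suc i) → refl }) φ)

lift-sub0∘lift-suc : (φ : Formula (suc n)) → rename (lift (sub0 y)) (rename (lift suc) φ) ≡ φ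
lift-sub0∘lift-suc φ = trans (rename-∘ _ _ φ) (rename-id (λ { zero → refl ; (suc i) → refl }) φ)

lift-suc-[suc] : (φ : Formula (suc n)) → rename (lift suc) φ [ suc y ] ≡ wk (φ [ y ])
lift-suc-[suc] {y = y} φ = trans (rename-∘ (sub0 (suc y)) (lift suc) φ)
  (trans (rename-cong (λ { zero → refl ; (suc i) → refl }) φ) (sym (rename-∘ suc (sub0 y) φ)))

∀∈I : ((0 ∈̇ suc x) ∷ map wk Γ) ⊢ φ → Γ ⊢ ∀∈ x φ
∀∈I d = ∀I (⇒I d)

∀∈E : Γ ⊢ ∀∈ x φ → Γ ⊢ y ∈̇ x → Γ ⊢ φ [ y ]
∀∈E {y = y} d e = ⇒E (∀E d y) e

∃∈I : (φ : Formula (suc n)) → Γ ⊢ y ∈̇ x → Γ ⊢ φ [ y ] → Γ ⊢ ∃∈ x φ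
∃∈I {y = y} {x = x} φ d e = ∃I {φ = 0 ∈̇ suc x ∧̇ φ} y (∧I d e)

∃∈E : Γ ⊢ ∃∈ x φ → (φ ∷ (0 ∈̇ suc x) ∷ map wk Γ) ⊢ wk ψ → Γ ⊢ ψ
∃∈E d e = ∃E d (cut (∧E₂ (# 0)) (cut (∧E₁ (# 1)) (weaken reorder e)))
  where
  reorder : (φ ∷ ψ ∷ Γ) ⊆ (ψ ∷ φ ∷ (ψ ∧̇ φ) ∷ Γ)
  reorder (here refl)         = there (here refl)
  reorder (there (here refl)) = here refl
  reorder (there (there p))   = there (there (there p))

∀∈E-fresh : {Γ : List (Formula (suc n))} {φ : Formula (suc n)} →
            Γ ⊢ wk (∀∈ x φ) → Γ ⊢ 0 ∈̇ suc x → Γ ⊢ φ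
∀∈E-fresh {φ = φ} d e = cast (lift-suc-[zero] φ) (∀∈E d e)

∃∈I-fresh : {Γ : List (Formula (suc n))} {φ : Formula (suc n)} →
            Γ ⊢ 0 ∈̇ suc x → Γ ⊢ φ → Γ ⊢ wk (∃∈ x φ)
∃∈I-fresh {φ = φ} d e = ∃∈I (rename (lift suc) φ) d (cast (sym (lift-suc-[zero] φ)) e)

≐subst-fresh : {Γ : List (Formula (suc n))} {φ : Formula (suc n)} →
               Γ ⊢ 0 ≐ suc y → Γ ⊢ φ → Γ ⊢ wk (φ [ y ])
≐subst-fresh {φ = φ} e d =
  cast (lift-suc-[suc] φ) (≐subst (rename (lift suc) φ) e (cast (sym (lift-suc-[zero] φ)) d))

≐-sym : Γ ⊢ x ≐ y → Γ ⊢ y ≐ x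
≐-sym {x = x} d = ≐subst (0 ≐ suc x) d (≐refl x)

≐-trans : Γ ⊢ x ≐ y → Γ ⊢ y ≐ z → Γ ⊢ x ≐ z
≐-trans {x = x} d e = ≐subst (suc x ≐ 0) e d

∈-substˡ : Γ ⊢ x ≐ y → Γ ⊢ x ∈̇ z → Γ ⊢ y ∈̇ z
∈-substˡ {z = z} d e = ≐subst (0 ∈̇ suc z) d e

∈-substʳ : Γ ⊢ x ≐ y → Γ ⊢ z ∈̇ x → Γ ⊢ z ∈̇ y
∈-substʳ {z = z} d e = ≐subst (suc z ∈̇ 0) d e

≐⇒⊆̇ : Γ ⊢ x ≐ y → Γ ⊢ x ⊆̇ y
≐⇒⊆̇ d = cut d (∀∈I (∈-substʳ (# 1) (# 0)))

⊆̇-antisym : Γ ⊢ x ⊆̇ y → Γ ⊢ y ⊆̇ x → Γ ⊢ x ≐ y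
⊆̇-antisym {x = x} {y = y} d e = assume (e ∷ d ∷ [])
  (⇒E (∀E (∀E (axm extensionality) x) y)
      (∀I (∧I (⇒I (∀∈E (# 2) (# 0))) (⇒I (∀∈E (# 1) (# 0))))))

Dec : Formula n → Formula n
Dec φ = φ ∨̇ ¬̇ φ

Dec-⊆̇⇒Dec-≐ : Γ ⊢ Dec (x ⊆̇ y) → Γ ⊢ Dec (y ⊆̇ x) → Γ ⊢ Dec (x ≐ y)
Dec-⊆̇⇒Dec-≐ d e = assume (e ∷ d ∷ []) (∨E (# 1)
  (∨E (# 1) (∨I₁ (⊆̇-antisym (# 1) (# 0))) (∨I₂ (⇒I (⇒E (# 1) (≐⇒⊆̇ (≐-sym (# 0)))))))
  (∨I₂ (⇒I (⇒E (# 1) (≐⇒⊆̇ (# 0))))))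

Dec-≐-sym : Γ ⊢ Dec (x ≐ y) → Γ ⊢ Dec (y ≐ x)
Dec-≐-sym d = cut d (∨E (# 0) (∨I₁ (≐-sym (# 0))) (∨I₂ (⇒I (⇒E (# 1) (≐-sym (# 0))))))

Dec-∃≐⇒Dec-∈ : Γ ⊢ Dec (∃∈ y (0 ≐ suc x)) → Γ ⊢ Dec (x ∈̇ y)
Dec-∃≐⇒Dec-∈ d = cut d (∨E (# 0)
  (∨I₁ (∃∈E (# 0) (∈-substˡ (# 0) (# 1))))
  (∨I₂ (⇒I (⇒E (# 1) (∃∈I _ (# 0) (≐refl _))))))

unorderedPair : (x y : Fin n) → Γ ⊢ ∃̇ (IsUPair 0 (suc x) (suc y))
unorderedPair x y = ∀E (∀E (axm pairing) x) y

IsUPair⇒IsSing : Γ ⊢ IsUPair x y y → Γ ⊢ IsSing x y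
IsUPair⇒IsSing d = cut d (∀I (∧I (⇒I (∨E (⇒E (∧E₁ (∀E (# 1) 0)) (# 0)) (# 0) (# 0)))
                                 (⇒I (⇒E (∧E₂ (∀E (# 1) 0)) (∨I₁ (# 0))))))

-- A Δ₀ consequence of p = ⟨u, v⟩ (IsOPair is not Δ₀) which, against IsOPair p a b,
-- still forces u = a and v = b.
IsPair₀ : Fin n → Fin n → Fin n → Formula n
IsPair₀ p u v =
  ∀∈ p (suc u ∈̇ 0) ∧̇ ∀∈ p (∀∈ 0 (0 ≐ suc (suc u) ∨̇ 0 ≐ suc (suc v))) ∧̇ ∃∈ p (suc v ∈̇ 0)

IsOPair⇒IsPair₀ : {p u v : Fin n} → Γ ⊢ IsOPair p u v → Γ ⊢ IsPair₀ p u v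
IsOPair⇒IsPair₀ {Γ = Γ} {p = p} {u} {v} d =
  cut d (∧I elements-contain-u (∧I elements-within-uv some-element-contains-v))
  where
  elements-contain-u : (IsOPair p u v ∷ Γ) ⊢ ∀∈ p (suc u ∈̇ 0)
  elements-contain-u = ∀∈I (∨E (⇒E (∧E₁ (∀E (# 1) 0)) (# 0))
    (⇒E (∧E₂ (∀E (# 0) (suc u))) (≐refl _))
    (⇒E (∧E₂ (∀E (# 0) (suc u))) (∨I₁ (≐refl _))))
  elements-within-uv : (IsOPair p u v ∷ Γ) ⊢ ∀∈ p (∀∈ 0 (0 ≐ suc (suc u) ∨̇ 0 ≐ suc (suc v)))
  elements-within-uv = ∀∈I (∨E (⇒E (∧E₁ (∀E (# 1) 0)) (# 0))
    (∀∈I (∨I₁ (⇒E (∧E₁ (∀E (# 1) 0)) (# 0))))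
    (∀∈I (⇒E (∧E₁ (∀E (# 1) 0)) (# 0))))
  some-element-contains-v : (IsOPair p u v ∷ Γ) ⊢ ∃∈ p (suc v ∈̇ 0)
  some-element-contains-v = ∃E (unorderedPair u v) (∃∈I (suc (suc v) ∈̇ 0)
    (⇒E (∧E₂ (∀E (# 1) 0)) (∨I₂ (# 0)))
    (⇒E (∧E₂ (∀E (# 0) (suc v))) (∨I₂ (≐refl _))))

IsPair₀-fst : {p u v a b : Fin n} → Γ ⊢ IsPair₀ p u v → Γ ⊢ IsOPair p a b → Γ ⊢ u ≐ a
IsPair₀-fst {u = u} {a = a} d e = assume (d ∷ e ∷ []) (∃E (unorderedPair a a)
  (cut (IsUPair⇒IsSing (# 0))
  (cut (⇒E (∧E₂ (∀E (# 3) 0)) (∨I₁ (# 0)))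
  (cut (∀∈E (∧E₁ (# 3)) (# 0))
  (⇒E (∧E₁ (∀E (# 2) (suc u))) (# 0))))))

-- {a, b} ∈ p gives b ∈ {u, v}; if b = u, then v lies in {a} or {a, b}, both ⊆ {u, b}.
IsPair₀-snd : {p u v a b : Fin n} → Γ ⊢ IsPair₀ p u v → Γ ⊢ IsOPair p a b → Γ ⊢ v ≐ b
IsPair₀-snd {v = v} {a} {b} d e = assume (d ∷ e ∷ []) (cut (IsPair₀-fst (# 0) (# 1))
  (∃E (unorderedPair a b)
  (cut (⇒E (∧E₂ (∀E (# 3) 0)) (∨I₂ (# 0)))
  (cut (⇒E (∧E₂ (∀E (# 1) (suc b))) (∨I₂ (≐refl _)))
  (∨E (∀∈E (∀∈E (∧E₁ (∧E₂ (# 4))) (# 1)) (# 0))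
    (∃∈E (∧E₂ (∧E₂ (# 5)))
      (∨E (⇒E (∧E₁ (∀E (# 8) 0)) (# 1))
        (≐-trans (≐-trans (⇒E (∧E₁ (∀E (# 0) (suc (suc v)))) (# 1)) (≐-sym (# 7))) (≐-sym (# 3)))
        (∨E (⇒E (∧E₁ (∀E (# 0) (suc (suc v)))) (# 1))
          (≐-trans (≐-trans (# 0) (≐-sym (# 8))) (≐-sym (# 4)))
          (# 0))))
    (≐-sym (# 0)))))))

Maps : Fin n → Fin n → Fin n → Formula n
Maps f u v = ∃∈ f (IsPair₀ 0 (suc u) (suc v))

Δ₀-Maps : (f u v : Fin n) → Δ₀ (Maps f u v)
Δ₀-Maps f u v =
  bex f (and (ball 0 (mem _ _)) (and (ball 0 (ball 0 (or (eq _ _) (eq _ _)))) (bex 0 (mem _ _))))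

Total Onto : Fin n → Fin n → Fin n → Formula n
Total f x N = ∀∈ x (∃∈ (suc N) (Maps (suc (suc f)) 1 0))
Onto  f x N = ∀∈ N (∃∈ (suc x) (Maps (suc (suc f)) 0 1))

Bij⇒Total : {f x N : Fin n} → Γ ⊢ Bij f x N → Γ ⊢ Total f x N
Bij⇒Total d = cut d (∀∈I (∃∈E (∀∈E (∧E₁ (∧E₂ (# 1))) (# 0)) (∃∈E (# 0)
  (∃∈I _ (# 3) (∃∈I _ (# 1) (IsOPair⇒IsPair₀ (# 0)))))))

Bij⇒Onto : {f x N : Fin n} → Γ ⊢ Bij f x N → Γ ⊢ Onto f x N
Bij⇒Onto d = cut d (∀∈I (∃∈E (∀∈E (∧E₂ (∧E₂ (∧E₂ (∧E₂ (# 1))))) (# 0)) (∃∈E (# 0)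
  (∃∈I _ (# 3) (∃∈I _ (# 1) (IsOPair⇒IsPair₀ (# 0)))))))

Bij-injective : {f x N a b v : Fin n} →
                Γ ⊢ Bij f x N → Γ ⊢ Maps f a v → Γ ⊢ Maps f b v → Γ ⊢ a ≐ b
Bij-injective bij fa=v fb=v = assume (fb=v ∷ fa=v ∷ bij ∷ [])
  (∃∈E (# 1) (∃∈E (# 2)
  (∃∈E (∀∈E (∧E₁ (# 6)) (# 3)) (∃∈E (# 0)
  (∃∈E (∀∈E (∧E₁ (# 10)) (# 5)) (∃∈E (# 0)
  (let a≐a₀ = IsPair₀-fst (# 10) (# 4)
       b≐b₁ = IsPair₀-fst (# 8) (# 0)
       v₀≐v₁ = ≐-trans (≐-sym (IsPair₀-snd (# 10) (# 4))) (IsPair₀-snd (# 8) (# 0))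
       p₁=⟨b₁,v₀⟩ = ≐subst (IsOPair 5 2 0) (≐-sym v₀≐v₁) (# 0)
       a₀≐b₁ = ⇒E (∀E (∀E (∀E (∀∈E (∀∈E (∧E₁ (∧E₂ (∧E₂ (∧E₂ (# 14))))) (# 11)) (# 9)) 3) 1) 2)
                  (∧I (# 4) p₁=⟨b₁,v₀⟩)
   in ≐-trans (≐-trans a≐a₀ a₀≐b₁) (≐-sym b≐b₁))))))))

_≤̇_ : Fin n → Fin n → Formula n
m ≤̇ N = m ∈̇ N ∨̇ m ≐ N

≤̇-Nat⇒ZeroOrSucc : {m N : Fin n} → Γ ⊢ Nat N → Γ ⊢ m ≤̇ N → Γ ⊢ ZeroOrSucc m
≤̇-Nat⇒ZeroOrSucc d e = assume (d ∷ e ∷ []) (∨E (# 1)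
  (∀∈E (∧E₂ (∧E₂ (# 1))) (# 0))
  (≐subst (ZeroOrSucc 0) (≐-sym (# 0)) (∧E₁ (∧E₂ (# 1)))))

≤̇-Trans⇒⊆̇ : {m N : Fin n} → Γ ⊢ Trans N → Γ ⊢ m ≤̇ N → Γ ⊢ m ⊆̇ N
≤̇-Trans⇒⊆̇ d e = assume (d ∷ e ∷ []) (∨E (# 1) (∀∈E (# 1) (# 0)) (∀∈I (∈-substʳ (# 1) (# 0))))

IsSucc⇒∈ : {m k : Fin n} → Γ ⊢ IsSucc m k → Γ ⊢ k ∈̇ m
IsSucc⇒∈ {k = k} d = ⇒E (∧E₂ (∀E d k)) (∨I₂ (≐refl k))

IsSucc⇒⊆̇ : {m k : Fin n} → Γ ⊢ IsSucc m k → Γ ⊢ k ⊆̇ m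
IsSucc⇒⊆̇ d = cut d (∀∈I (⇒E (∧E₂ (∀E (# 1) 0)) (∨I₁ (# 0))))

∈-IsSucc⁻ : {m k v : Fin n} → Γ ⊢ IsSucc m k → Γ ⊢ v ∈̇ m → Γ ⊢ v ∈̇ k ∨̇ v ≐ k
∈-IsSucc⁻ {v = v} d e = ⇒E (∧E₁ (∀E d v)) e

Below : Formula (suc n) → Fin n → Fin n → Fin n → Formula n
Below φ f x m = ∃∈ x (φ ∧̇ ∃∈ (suc m) (Maps (suc (suc f)) 1 0))

Δ₀-Below : {φ : Formula (suc n)} (f x m : Fin n) → Δ₀ φ → Δ₀ (Below φ f x m)
Δ₀-Below f x m d = bex x (and d (bex (suc m) (Δ₀-Maps _ _ _)))

¬Below-∅ : {φ : Formula (suc n)} {f x m : Fin n} → Γ ⊢ IsEmpty m → Γ ⊢ ¬̇ Below φ f x m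
¬Below-∅ d = cut d (⇒I (∃∈E (# 0) (∃∈E (∧E₂ (# 0)) (⇒E (∀E (# 5) 0) (# 1)))))

Below-mono : {φ : Formula (suc n)} {f x k m : Fin n} →
             Γ ⊢ k ⊆̇ m → Γ ⊢ Below φ f x k → Γ ⊢ Below φ f x m
Below-mono s d = assume (d ∷ s ∷ []) (∃∈E (# 0) (∃∈I-fresh (# 1) (∧I (∧E₁ (# 0))
  (∃∈E (∧E₂ (# 0)) (∃∈I-fresh (∀∈E (# 5) (# 1)) (# 0))))))

Dec-Below⇒Dec-∃∈ : {φ : Formula (suc n)} {f x N : Fin n} →
                   Γ ⊢ Total f x N → Γ ⊢ Dec (Below φ f x N) → Γ ⊢ Dec (∃∈ x φ)
Dec-Below⇒Dec-∃∈ t d = assume (t ∷ d ∷ []) (∨E (# 1)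
  (∨I₁ (∃∈E (# 0) (∃∈I-fresh (# 1) (∧E₁ (# 0)))))
  (∨I₂ (⇒I (∃∈E (# 0) (⇒E (# 3) (∃∈I-fresh (# 1) (∧I (# 0) (∀∈E (# 4) (# 1)))))))))

-- If y ∈ x, φ(y) and f(y) ∈ k ∪ {k}, then f(y) ∈ k is excluded, and f(y) = k forces y = u.
¬Below-succ : {φ : Formula (suc n)} {f x N u k m : Fin n} →
              Γ ⊢ Bij f x N → Γ ⊢ Maps f u k → Γ ⊢ ¬̇ (φ [ u ]) → Γ ⊢ IsSucc m k →
              Γ ⊢ ¬̇ Below φ f x k → Γ ⊢ ¬̇ Below φ f x m
¬Below-succ {f = f} bij fu=k ¬φu m=k⁺ ¬below-k = assume (bij ∷ fu=k ∷ ¬φu ∷ m=k⁺ ∷ ¬below-k ∷ [])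
  (⇒I (∃∈E (# 0)
    (cut (⇒I (⇒E (# 8) (∃∈I-fresh (# 2) (∧I (∧E₁ (# 1)) (# 0)))))
    (⇒E (# 6) (≐subst-fresh
      (∃∈E (∧E₂ (# 1)) (∨E (∈-IsSucc⁻ (# 9) (# 1))
        (⊥E (⇒E (# 3) (∃∈I _ (# 0) (# 1))))
        (Bij-injective (# 7) (≐subst (Maps (suc (suc (suc f))) 2 0) (# 0) (# 1)) (# 8))))
      (∧E₁ (# 1)))))))

-- Below the successor of k, the only new candidate is the preimage u of k.
Dec-Below-succ : {φ : Formula (suc n)} {f x N k m : Fin n} →
                 Γ ⊢ Bij f x N → Γ ⊢ ∀∈ x (Dec φ) → Γ ⊢ k ∈̇ N → Γ ⊢ IsSucc m k →
                 Γ ⊢ Dec (Below φ f x k) → Γ ⊢ Dec (Below φ f x m)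
Dec-Below-succ bij dec k∈N m=k⁺ below-k? = assume (below-k? ∷ bij ∷ dec ∷ k∈N ∷ m=k⁺ ∷ []) (∨E (# 0)
  (∨I₁ (Below-mono (IsSucc⇒⊆̇ (# 5)) (# 0)))
  (∃∈E (∀∈E (Bij⇒Onto (# 2)) (# 4)) (∨E (∀∈E (# 5) (# 1))
    (∨I₁ (∃∈I _ (# 2) (∧I (# 0) (∃∈I _ (IsSucc⇒∈ (# 8)) (# 1)))))
    (∨I₂ (¬Below-succ (# 5) (# 1) (# 0) (# 8) (# 3))))))

SearchInv : Formula (suc n) → Fin n → Fin n → Fin n → Formula (suc n)
SearchInv φ f x N = (0 ≤̇ suc N) ⇒̇ Dec (Below (rename (lift suc) φ) (suc f) (suc x) 0)

Δ₀-SearchInv : {φ : Formula (suc n)} (f x N : Fin n) → Δ₀ φ → Δ₀ (SearchInv φ f x N)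
Δ₀-SearchInv {φ = φ} f x N d = imp (or (mem _ _) (eq _ _)) (or Δ₀-below (imp Δ₀-below bot))
  where
  Δ₀-below : Δ₀ (Below (rename (lift suc) φ) (suc f) (suc x) 0)
  Δ₀-below = Δ₀-Below (suc f) (suc x) 0 (Δ₀-rename (lift suc) d)

Dec-∃∈-Bij : {φ : Formula (suc n)} {f x N : Fin n} → Δ₀ φ →
             Γ ⊢ Bij f x N → Γ ⊢ Nat N → Γ ⊢ ∀∈ x (Dec φ) → Γ ⊢ Dec (∃∈ x φ)
Dec-∃∈-Bij {Γ = Γ} {φ = φ} {f} {x} {N} δφ bij nat dec = assume (bij ∷ nat ∷ dec ∷ [])
  (Dec-Below⇒Dec-∃∈ (Bij⇒Total (# 0))
    (cast (cong (λ ψ → Dec (Below ψ f x N)) (lift-sub0∘lift-suc φ))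
      (⇒E (∀E (⇒E (ind (δ (Δ₀-SearchInv f x N δφ))) (∀I (⇒I (⇒I step)))) N) (∨I₂ (≐refl N)))))
  where
  -- φ as it occurs in the induction hypothesis at k, and as Dec-Below-succ expects it.
  IH-renaming : rename (lift (sub0 0)) (rename (lift (lift suc))
                  (rename (lift (lift suc)) (rename (lift suc) φ)))
                ≡ rename (lift suc) (rename (lift suc) φ)
  IH-renaming = trans (cong (rename _) (trans (cong (rename _) (rename-∘ _ _ φ)) (rename-∘ _ _ φ)))
    (trans (rename-∘ _ _ φ)
      (trans (rename-cong (λ { zero → refl ; (suc i) → refl }) φ) (sym (rename-∘ _ _ φ))))
  step : ((0 ≤̇ suc N) ∷ ∀∈ 0 (rename (lift suc) (SearchInv φ f x N)) ∷
          map wk (Bij f x N ∷ Nat N ∷ ∀∈ x (Dec φ) ∷ Γ))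
         ⊢ Dec (Below (rename (lift suc) φ) (suc f) (suc x) 0)
  step = ∨E (≤̇-Nat⇒ZeroOrSucc (# 3) (# 0))
    (∨I₂ (¬Below-∅ (# 0)))
    (∃∈E (# 0) (cut (∀∈E (≤̇-Trans⇒⊆̇ (∧E₁ (∧E₁ (# 6))) (# 3)) (# 1))
      (Dec-Below-succ (# 6) (# 8) (# 0) (# 1)
        (cast (cong (λ ψ → Dec (Below ψ (suc (suc f)) (suc (suc x)) 0)) IH-renaming)
          (⇒E (∀∈E (# 5) (# 2)) (∨I₁ (# 0)))))))

Dec-∃∈ : {φ : Formula (suc n)} → Δ₀ φ → Γ ⊢ ∀∈ x (Dec φ) → Γ ⊢ Dec (∃∈ x φ)
Dec-∃∈ {x = x} δφ d = cut d (∃E (∀E (axm vfin) x) (∃E (∧E₂ (# 0))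
  (Dec-∃∈-Bij (Δ₀-rename _ (Δ₀-rename _ δφ)) (# 0) (∧E₁ (# 1)) (# 2))))

Dec-∀∈ : {φ : Formula (suc n)} → Δ₀ φ → Γ ⊢ ∀∈ x (Dec φ) → Γ ⊢ Dec (∀∈ x φ)
Dec-∀∈ δφ d = cut d (∨E
  (Dec-∃∈ (imp δφ bot) (∀∈I (∨E (∀∈E-fresh (# 1) (# 0)) (∨I₂ (⇒I (⇒E (# 0) (# 1)))) (∨I₁ (# 0)))))
  (∨I₂ (⇒I (∃∈E (# 1) (⇒E (# 0) (∀∈E-fresh (# 2) (# 1))))))
  (∨I₁ (∀∈I (∨E (∀∈E-fresh (# 2) (# 0)) (# 0) (⊥E (⇒E (# 2) (∃∈I-fresh (# 1) (# 0))))))))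

Decides : Fin n → Fin n → Formula n
Decides α b = ∀∈ α (Dec (suc b ≐ 0)) ∧̇ ∀∈ α (Dec (suc b ∈̇ 0))

Δ₀-Decides : (α b : Fin n) → Δ₀ (Decides α b)
Δ₀-Decides α b =
  and (ball α (or (eq _ _) (imp (eq _ _) bot))) (ball α (or (mem _ _) (imp (mem _ _) bot)))

-- Transitivity of α keeps the elements of y ∈ α inside α, where the induction hypothesis applies.
Trans⇒Decides : {α : Fin n} → Γ ⊢ Trans α → Γ ⊢ ∀̇ (Decides (suc α) 0)
Trans⇒Decides {n = n} {Γ = Γ} {α = α} t =
  cut t (⇒E (ind (δ (Δ₀-Decides _ _))) (∀I (⇒I (cut equalities (∧I (# 0) memberships)))))
  where
  IH : Formula (suc n)
  IH = ∀∈ 0 (rename (lift suc) (Decides (suc α) 0))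
  equalities : (IH ∷ map wk (Trans α ∷ Γ)) ⊢ ∀∈ (suc α) (Dec (1 ≐ 0))
  equalities = ∀∈I (Dec-⊆̇⇒Dec-≐
    (Dec-∀∈ (mem _ _) (∀∈I (∀∈E (∧E₂ (∀∈E (# 2) (# 0))) (# 1))))
    (Dec-∀∈ (mem _ _) (∀∈I (cut (∀∈E (∀∈E (# 3) (# 1)) (# 0))
      (Dec-∃≐⇒Dec-∈ (Dec-∃∈ (eq _ _) (∀∈I (∀∈E (∧E₁ (∀∈E (# 4) (# 0))) (# 1)))))))))
  memberships : (∀∈ (suc α) (Dec (1 ≐ 0)) ∷ IH ∷ map wk (Trans α ∷ Γ)) ⊢ ∀∈ (suc α) (Dec (1 ∈̇ 0))
  memberships = ∀∈I (Dec-∃≐⇒Dec-∈ (Dec-∃∈ (eq _ _) (∀∈I (cut (∀∈E (∀∈E (# 4) (# 1)) (# 0))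
    (Dec-≐-sym (∀∈E (# 3) (# 0)))))))

∈-Decidable : Fin n → Formula n
∈-Decidable A = ∀∈ A (∀∈ (suc A) (Dec (0 ∈̇ 1)))

Trans⇒∈-Decidable : {α : Fin n} → Γ ⊢ Trans α → Γ ⊢ ∈-Decidable α
Trans⇒∈-Decidable t = cut (Trans⇒Decides t) (∀∈I (∀∈I (∀∈E (∧E₂ (∀E (# 2) 0)) (# 1))))

∈-Decidable-⊆̇ : {A α : Fin n} → Γ ⊢ A ⊆̇ α → Γ ⊢ ∈-Decidable α → Γ ⊢ ∈-Decidable A
∈-Decidable-⊆̇ s d = assume (d ∷ s ∷ [])
  (∀∈I (∀∈I (∀∈E (∀∈E (# 2) (∀∈E (# 3) (# 1))) (∀∈E (# 3) (# 0)))))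

HasMinimal : Fin n → Formula n
HasMinimal A = ∃∈ A (¬̇ ∃∈ (suc A) (0 ∈̇ 1))

Δ₀-HasMinimal : (A : Fin n) → Δ₀ (HasMinimal A)
Δ₀-HasMinimal A = bex A (imp (bex _ (mem _ _)) bot)

∈-Decidable⇒HasMinimal : {A : Fin n} → Γ ⊢ ∈-Decidable A → Γ ⊢ x ∈̇ A → Γ ⊢ HasMinimal A
∈-Decidable⇒HasMinimal {n = n} {Γ = Γ} {x = x} {A = A} d x∈A = assume (d ∷ x∈A ∷ [])
  (⇒E (∀E (⇒E (ind {φ = Inv} (δ (imp (mem _ _) (Δ₀-HasMinimal _)))) (∀I (⇒I (⇒I step)))) x) (# 1))
  where
  Inv : Formula (suc n)
  Inv = 0 ∈̇ suc A ⇒̇ HasMinimal (suc A)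
  step : ((0 ∈̇ suc A) ∷ ∀∈ 0 (rename (lift suc) Inv) ∷ map wk (∈-Decidable A ∷ x ∈̇ A ∷ Γ))
         ⊢ HasMinimal (suc A)
  step = ∨E (Dec-∃∈ (mem _ _) (∀∈E (# 2) (# 0)))
    (∃∈E (# 0) (⇒E (∀∈E (# 4) (# 0)) (# 1)))
    (∃∈I _ (# 1) (# 0))

mainTheorem13 : SIE₁⊢ MinimalElementSentence
mainTheorem13 = ∀I (⇒I (∀I (⇒I (⇒I (∃E (# 0)
  (∈-Decidable⇒HasMinimal (∈-Decidable-⊆̇ (# 2) (Trans⇒∈-Decidable (∧E₁ (# 3)))) (# 0)))))))
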